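{- Let $q=p^n$, $p$ prime, and let $\mathcal S$ be a mod $p$ generalized KM-arc of type $(0,m,t)_p$ in a projective plane of order $q$ with $t\neq m$. Let $Q\notin\mathcal S$ be a point. If no $0$-secant of $\mathcal S$ is incident with $Q$, or $m=0$, then the number of $t_p$-secants of $\mathcal S$ incident with $Q$ is congruent to $1\pmod p$.
   Context: For a point set $\mathcal S$, an $i_p$-secant ($0\le i\le p-1$) is a line meeting $\mathcal S$ in a number of points congruent to $i\pmod p$; a $0$-secant is a line disjoint from $\mathcal S$. A mod $p$ generalized KM-arc of type $(0,m,t)_p$ in a projective plane of order $q=p^n$ is a proper non-empty point set $\mathcal S$ such that every point $R\in\mathcal S$ is incident with a $t_p$-secant and the other $q$ lines through $R$ are $m_p$-secants, where $0\le m,t\le p-1$. -}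

module Defs where

open import Data.Nat using (ℕ; zero; suc; _+_; _*_; _%_; NonZero)
open import Data.Fin using (Fin)
import Data.Fin as Fin
open import Data.Bool using (Bool; true; false; if_then_else_; _∧_)
open import Data.Product using (Σ; ∃; _×_; _,_)
open import Relation.Binary.PropositionalEquality using (_≡_; _≢_)
open import Relation.Nullary using (¬_)

count : ∀ {v} → (Fin v → Bool) → ℕ
count {zero}  f = 0
count {suc v} f = (if f Fin.zero then 1 else 0) + count (λ x → f (Fin.suc x))

size : ℕ → ℕ
size q = q * q + q + 1

record ProjectivePlane (q : ℕ) : Set where
  field
    I : Fin (size q) → Fin (size q) → Bool
    joinUnique : ∀ P R → P ≢ R →
      Σ (Fin (size q)) λ ℓ → (I P ℓ ≡ true × I R ℓ ≡ true) ×
        (∀ ℓ′ → I P ℓ′ ≡ true → I R ℓ′ ≡ true → ℓ′ ≡ ℓ)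
    meetUnique : ∀ ℓ m → ℓ ≢ m →
      Σ (Fin (size q)) λ P → (I P ℓ ≡ true × I P m ≡ true) ×
        (∀ P′ → I P′ ℓ ≡ true → I P′ m ≡ true → P′ ≡ P)
    linePoints : ∀ ℓ → count (λ P → I P ℓ) ≡ suc q
    pointLines : ∀ P → count (λ ℓ → I P ℓ) ≡ suc q

module _ {q : ℕ} (Π : ProjectivePlane q) where
  open ProjectivePlane Π

  Point = Fin (size q)
  Line  = Fin (size q)

  PointSet = Point → Bool

  meet : PointSet → Line → ℕ
  meet S ℓ = count (λ P → I P ℓ ∧ S P)

  -- ℓ is an i_p-secant of S: |ℓ ∩ S| ≡ i (mod p)  (with 0 ≤ i ≤ p-1)
  Secant : (p : ℕ) → .{{NonZero p}} → ℕ → PointSet → Line → Set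
  Secant p i S ℓ = meet S ℓ % p ≡ i

  ZeroSecant : PointSet → Line → Set
  ZeroSecant S ℓ = meet S ℓ ≡ 0

  record GenKMArc (p : ℕ) .{{_ : NonZero p}} (m t : ℕ) (S : PointSet) : Set where
    field
      nonEmpty : ∃ λ P → S P ≡ true
      proper   : ∃ λ P → S P ≡ false
      tangent  : ∀ R → S R ≡ true →
        Σ Line λ ℓ → I R ℓ ≡ true × Secant p t S ℓ ×
          (∀ ℓ′ → I R ℓ′ ≡ true → ℓ′ ≢ ℓ → Secant p m S ℓ′)

  numSecantsThrough : (p : ℕ) → .{{NonZero p}} → ℕ → PointSet → Point → ℕ
  numSecantsThrough p t S Q =
    count (λ ℓ → I Q ℓ ∧ (Data.Nat._≡ᵇ_ (meet S ℓ % p) t))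
    where import Data.Nat

-- Let S be a mod p generalized KM-arc of type (0,m,t)_p in a projective plane
-- of order q = p^n, let Q ∉ S, and let x (resp. y) be the number of lines
-- through Q that are (resp. are not) t_p-secants.  We count |S| modulo p twice.
--   * Through Q: the lines through Q partition S.  A line meeting S that is
--     not a t_p-secant is an m_p-secant (a point of S lies on only one
--     t_p-secant), and a line through Q missing S contributes 0 ≡ m when m = 0
--     and does not exist otherwise; hence |S| ≡ x t + y m.
--   * Through R ∈ S: the lines through R cover S with R counted q + 1 times,
--     and R lies on one t_p-secant and q m_p-secants; since p ∣ q, |S| ≡ t.
-- With x + y = q + 1 ≡ 1 this gives (x - 1)(t - m) ≡ 0, so x ≡ 1 because p is
-- prime and t, m are distinct residues.
module Submission where

open import Defs
open import Data.Nat
open import Data.Nat.Properties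
open import Data.Nat.DivMod hiding (_mod_)
open import Data.Nat.Divisibility
open import Data.Nat.Primality using (Prime; euclidsLemma; prime⇒nonTrivial)
open import Data.Nat.Tactic.RingSolver using (solve-∀)
open import Data.Fin using (Fin; zero; suc)
import Data.Fin.Properties as Fin
open import Data.Bool using (Bool; true; false; if_then_else_; _∧_; not; T)
open import Data.Bool.Properties using (∧-idem)
open import Data.Product using (∃; _×_; _,_; proj₁; proj₂)
open import Data.Sum using (_⊎_; inj₁; inj₂)
open import Data.Unit using (tt)
open import Data.Empty using (⊥-elim)
open import Function using (_∘_)
open import Relation.Binary.PropositionalEquality
open import Relation.Binary.Definitions using (tri<; tri≈; tri>)
open import Relation.Nullary using (¬_; yes; no)
open import Algebra.Properties.CommutativeMonoid.Sum +-0-commutativeMonoid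
  using (sum; ∑-distrib-+; ∑-comm; sum-cong-≗; sum-replicate-zero)
open ProjectivePlane

onlyIf : Bool → ℕ → ℕ
onlyIf b c = if b then c else 0

onlyIf-zero : ∀ b → onlyIf b 0 ≡ 0
onlyIf-zero true  = refl
onlyIf-zero false = refl

both-true : ∀ {a b} → a ∧ b ≡ true → a ≡ true × b ≡ true
both-true {true} {true} refl = refl , refl

onlyIf-sum : ∀ {v} b (f : Fin v → ℕ) → onlyIf b (sum f) ≡ sum (λ x → onlyIf b (f x))
onlyIf-sum true  f = refl
onlyIf-sum {v} false f = sym (sum-replicate-zero v)

count-as-sum : ∀ {v} (f : Fin v → Bool) → count f ≡ sum (λ x → onlyIf (f x) 1)
count-as-sum {zero}  f = refl
count-as-sum {suc v} f = cong (onlyIf (f zero) 1 +_) (count-as-sum (f ∘ suc))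

count-cong : ∀ {v} {f g : Fin v → Bool} → (∀ x → f x ≡ g x) → count f ≡ count g
count-cong {zero}  eq = refl
count-cong {suc v} eq =
  cong₂ (λ b n → onlyIf b 1 + n) (eq zero) (count-cong (eq ∘ suc))

count-none : ∀ {v} (f : Fin v → Bool) → (∀ x → f x ≡ false) → count f ≡ 0
count-none {zero}  f none = refl
count-none {suc v} f none rewrite none zero = count-none (f ∘ suc) (none ∘ suc)

count-unique : ∀ {v} (f : Fin v → Bool) w → f w ≡ true →
  (∀ x → f x ≡ true → x ≡ w) → count f ≡ 1
count-unique {suc v} f zero fw only-w rewrite fw =
  cong suc (count-none (f ∘ suc) others-false)
  where
  others-false : ∀ x → f (suc x) ≡ false
  others-false x with f (suc x) in fx
  ... | false = refl
  ... | true  = ⊥-elim (Fin.0≢1+n (sym (only-w (suc x) fx)))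
count-unique {suc v} f (suc w) fw only-w with f zero in f0
... | true  = ⊥-elim (Fin.0≢1+n (only-w zero f0))
... | false = count-unique (f ∘ suc) w fw (λ x fx → Fin.suc-injective (only-w (suc x) fx))

count-witness : ∀ {v} (f : Fin v → Bool) → count f ≢ 0 → ∃ λ x → f x ≡ true
count-witness {zero}  f nonzero = ⊥-elim (nonzero refl)
count-witness {suc v} f nonzero with f zero in f0
... | true  = zero , f0
... | false = let x , fx = count-witness (f ∘ suc) nonzero in suc x , fx

count-split : ∀ {v} (f g : Fin v → Bool) →
  count f ≡ count (λ x → f x ∧ g x) + count (λ x → f x ∧ not (g x))
count-split {zero}  f g = refl
count-split {suc v} f g with f zero | g zero | count-split (f ∘ suc) (g ∘ suc)
... | true  | true  | split = cong suc split
... | true  | false | split = trans (cong suc split) (sym (+-suc _ _))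
... | false | _     | split = split

sum-onlyIf-const : ∀ {v} (f : Fin v → Bool) c →
  sum (λ x → onlyIf (f x) c) ≡ count f * c
sum-onlyIf-const {zero}  f c = refl
sum-onlyIf-const {suc v} f c with f zero
... | true  = cong (c +_) (sum-onlyIf-const (f ∘ suc) c)
... | false = sum-onlyIf-const (f ∘ suc) c

sum-onlyIf-if : ∀ {v} (f g : Fin v → Bool) a c →
  sum (λ x → onlyIf (f x) (if g x then a else c)) ≡
  count (λ x → f x ∧ g x) * a + count (λ x → f x ∧ not (g x)) * c
sum-onlyIf-if f g a c = begin
  sum (λ x → onlyIf (f x) (if g x then a else c))
    ≡⟨ sum-cong-≗ split ⟩
  sum (λ x → onlyIf (f x ∧ g x) a + onlyIf (f x ∧ not (g x)) c)
    ≡⟨ ∑-distrib-+ (λ x → onlyIf (f x ∧ g x) a) (λ x → onlyIf (f x ∧ not (g x)) c) ⟩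
  sum (λ x → onlyIf (f x ∧ g x) a) + sum (λ x → onlyIf (f x ∧ not (g x)) c)
    ≡⟨ cong₂ _+_ (sum-onlyIf-const (λ x → f x ∧ g x) a) (sum-onlyIf-const (λ x → f x ∧ not (g x)) c) ⟩
  count (λ x → f x ∧ g x) * a + count (λ x → f x ∧ not (g x)) * c ∎
  where
  open ≡-Reasoning
  split : ∀ x → onlyIf (f x) (if g x then a else c) ≡
                onlyIf (f x ∧ g x) a + onlyIf (f x ∧ not (g x)) c
  split x with f x | g x
  ... | true  | true  = sym (+-identityʳ a)
  ... | true  | false = refl
  ... | false | _     = refl

sum-onlyIf-except : ∀ {v} (f : Fin v → Bool) (h : Fin v → ℕ) w a c →
  f w ≡ true → h w ≡ a → (∀ x → f x ≡ true → x ≢ w → h x ≡ c) →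
  sum (λ x → onlyIf (f x) (h x)) + c ≡ count f * c + a
sum-onlyIf-except {suc v} f h zero a c fw hw hc rewrite fw | hw = begin
  a + rest + c           ≡⟨ cong (λ s → a + s + c) rest-const ⟩
  a + k * c + c          ≡⟨ swap a (k * c) c ⟩
  c + k * c + a          ∎
  where
  open ≡-Reasoning
  rest = sum (λ x → onlyIf (f (suc x)) (h (suc x)))
  k = count (f ∘ suc)
  swap : ∀ a b c → a + b + c ≡ c + b + a
  swap = solve-∀
  rest-const : rest ≡ k * c
  rest-const = trans (sum-cong-≗ λ x → at x) (sum-onlyIf-const (f ∘ suc) c)
    where
    at : ∀ x → onlyIf (f (suc x)) (h (suc x)) ≡ onlyIf (f (suc x)) c
    at x with f (suc x) in fx
    ... | true  = hc (suc x) fx (λ ())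
    ... | false = refl
sum-onlyIf-except {suc v} f h (suc w) a c fw hw hc with f zero in f0
... | false = sum-onlyIf-except (f ∘ suc) (h ∘ suc) w a c fw hw hc′
  where hc′ = λ x fx x≢w → hc (suc x) fx (x≢w ∘ Fin.suc-injective)
... | true rewrite hc zero f0 (λ ()) = begin
  c + rest + c           ≡⟨ +-assoc c rest c ⟩
  c + (rest + c)         ≡⟨ cong (c +_) (sum-onlyIf-except (f ∘ suc) (h ∘ suc) w a c fw hw hc′) ⟩
  c + (k * c + a)        ≡⟨ sym (+-assoc c (k * c) a) ⟩
  c + k * c + a          ∎
  where
  open ≡-Reasoning
  rest = sum (λ x → onlyIf (f (suc x)) (h (suc x)))
  k = count (f ∘ suc)
  hc′ = λ x fx x≢w → hc (suc x) fx (x≢w ∘ Fin.suc-injective)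

-- Congruence modulo p, as equality of remainders; since it unfolds to an
-- equation between naturals, ≡-Reasoning applies to it directly.
infix 4 _≡_mod_

_≡_mod_ : ℕ → ℕ → (p : ℕ) → .{{NonZero p}} → Set
a ≡ b mod p = a % p ≡ b % p

module Modulo (p : ℕ) .{{_ : NonZero p}} where

  0%p≡0 : 0 % p ≡ 0
  0%p≡0 = m<n⇒m%n≡m (>-nonZero⁻¹ p)

  +-cong-mod : ∀ {a b c d} → a ≡ b mod p → c ≡ d mod p → a + c ≡ b + d mod p
  +-cong-mod {a} {b} {c} {d} a≡b c≡d = begin
    (a + c) % p          ≡⟨ %-distribˡ-+ a c p ⟩
    (a % p + c % p) % p  ≡⟨ cong₂ (λ u v → (u + v) % p) a≡b c≡d ⟩
    (b % p + d % p) % p  ≡⟨ sym (%-distribˡ-+ b d p) ⟩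
    (b + d) % p          ∎
    where open ≡-Reasoning

  *-cong-mod : ∀ {a b c d} → a ≡ b mod p → c ≡ d mod p → a * c ≡ b * d mod p
  *-cong-mod {a} {b} {c} {d} a≡b c≡d = begin
    (a * c) % p            ≡⟨ %-distribˡ-* a c p ⟩
    (a % p * (c % p)) % p  ≡⟨ cong₂ (λ u v → (u * v) % p) a≡b c≡d ⟩
    (b % p * (d % p)) % p  ≡⟨ sym (%-distribˡ-* b d p) ⟩
    (b * d) % p            ∎
    where open ≡-Reasoning

  -- Addition modulo p is cancellative: add the "negative" a * p ∸ a of a.
  +-cancelˡ-mod : ∀ a {b c} → a + b ≡ a + c mod p → b ≡ c mod p
  +-cancelˡ-mod a {b} {c} ab≡ac = begin
    b % p                ≡⟨ sym (shift b) ⟩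
    (u + (a + b)) % p    ≡⟨ +-cong-mod {u} refl ab≡ac ⟩
    (u + (a + c)) % p    ≡⟨ shift c ⟩
    c % p                ∎
    where
    open ≡-Reasoning
    u = a * p ∸ a
    shift : ∀ z → (u + (a + z)) % p ≡ z % p
    shift z = begin
      (u + (a + z)) % p  ≡⟨ cong (_% p) (sym (+-assoc u a z)) ⟩
      (u + a + z) % p    ≡⟨ cong (λ s → (s + z) % p) (m∸n+n≡m (m≤m*n a p)) ⟩
      (a * p + z) % p    ≡⟨ %-remove-+ˡ z (n∣m*n a) ⟩
      z % p              ∎

  sum-cong-mod : ∀ {v} {g h : Fin v → ℕ} → (∀ x → g x ≡ h x mod p) →
    sum g ≡ sum h mod p
  sum-cong-mod {zero}  eq = refl
  sum-cong-mod {suc v} eq = +-cong-mod (eq zero) (sum-cong-mod (eq ∘ suc))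

  sum-onlyIf-mod : ∀ {v} (f : Fin v → Bool) (g : Fin v → ℕ) →
    sum (λ x → onlyIf (f x) (g x)) ≡ sum (λ x → onlyIf (f x) (g x % p)) mod p
  sum-onlyIf-mod f g = sum-cong-mod reduce
    where
    reduce : ∀ x → onlyIf (f x) (g x) ≡ onlyIf (f x) (g x % p) mod p
    reduce x with f x
    ... | true  = sym (m%n%n≡m%n (g x) p)
    ... | false = refl

  module _ (p-prime : Prime p) where

    fixes-unit⇒one : ∀ x {d} → 0 < d → d < p → x * d ≡ d mod p → x ≡ 1 mod p
    fixes-unit⇒one zero {d} 0<d d<p 0≡d =
      ⊥-elim (<⇒≢ 0<d (trans (sym 0%p≡0) (trans 0≡d (m<n⇒m%n≡m d<p))))
    fixes-unit⇒one (suc x) {d} 0<d d<p xd+d≡d =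
      %-remove-+ʳ 1 (euclid (m%n≡0⇒n∣m (x * d) p (trans xd≡0 0%p≡0)))
      where
      xd≡0 : x * d ≡ 0 mod p
      xd≡0 = +-cancelˡ-mod d (trans xd+d≡d (cong (_% p) (sym (+-identityʳ d))))
      -- p cannot divide d, as 0 < d < p
      euclid : p ∣ x * d → p ∣ x
      euclid p∣xd with euclidsLemma x d p-prime p∣xd
      ... | inj₁ p∣x = p∣x
      ... | inj₂ p∣d = ⊥-elim (<⇒≱ d<p (∣⇒≤ {{>-nonZero 0<d}} p∣d))

    -- The congruence x t + m ≡ x m + t, i.e. (x - 1)(t - m) ≡ 0, for residues m < t.
    cancel-ordered : ∀ x {m t} → m < t → t < p →
      x * t + m ≡ x * m + t mod p → x ≡ 1 mod p
    cancel-ordered x {m} m<t t<p eq with m≤n⇒∃[o]m+o≡n m<t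
    ... | o , refl = fixes-unit⇒one x {suc o} (s≤s z≤n) (≤-<-trans (s≤s (m≤n+m o m)) t<p)
        (+-cancelˡ-mod (x * m + m) (begin
          (x * m + m + x * suc o) % p  ≡⟨ cong (_% p) (lhs x m o) ⟩
          (x * suc (m + o) + m) % p    ≡⟨ eq ⟩
          (x * m + suc (m + o)) % p    ≡⟨ cong (_% p) (rhs x m o) ⟩
          (x * m + m + suc o) % p      ∎))
      where
      open ≡-Reasoning
      lhs : ∀ x m o → x * m + m + x * suc o ≡ x * suc (m + o) + m
      lhs = solve-∀
      rhs : ∀ x m o → x * m + suc (m + o) ≡ x * m + m + suc o
      rhs = solve-∀

    cancel-distinct : ∀ x {m t} → m < p → t < p → t ≢ m →
      x * t + m ≡ x * m + t mod p → x ≡ 1 mod p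
    cancel-distinct x {m} {t} m<p t<p t≢m eq with <-cmp m t
    ... | tri< m<t _ _ = cancel-ordered x m<t t<p eq
    ... | tri≈ _ m≡t _ = ⊥-elim (t≢m (sym m≡t))
    ... | tri> _ _ t<m = cancel-ordered x t<m m<p (sym eq)

    solve-for-x : ∀ x y {m t} → m < p → t < p → t ≢ m →
      x * t + y * m ≡ t mod p → x + y ≡ 1 mod p → x ≡ 1 mod p
    solve-for-x x y {m} {t} m<p t<p t≢m sum≡t x+y≡1 =
      cancel-distinct x m<p t<p t≢m (begin
        (x * t + m) % p                ≡⟨ cong (λ s → (x * t + s) % p) (sym (*-identityˡ m)) ⟩
        (x * t + 1 * m) % p            ≡⟨ +-cong-mod {x * t} refl (*-cong-mod (sym x+y≡1) refl) ⟩
        (x * t + (x + y) * m) % p      ≡⟨ cong (_% p) (regroup x y t m) ⟩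
        (x * t + y * m + x * m) % p    ≡⟨ +-cong-mod sum≡t refl ⟩
        (t + x * m) % p                ≡⟨ cong (_% p) (+-comm t (x * m)) ⟩
        (x * m + t) % p                ∎)
      where
      open ≡-Reasoning
      regroup : ∀ x y t m → x * t + (x + y) * m ≡ x * t + y * m + x * m
      regroup = solve-∀

module DoubleCounting {q : ℕ} (Π : ProjectivePlane q) where

  pencilSum : Point Π → (Line Π → ℕ) → ℕ
  pencilSum X f = sum (λ ℓ → onlyIf (I Π X ℓ) (f ℓ))

  lines-through-one : ∀ X → count (λ ℓ → I Π X ℓ ∧ I Π X ℓ) ≡ suc q
  lines-through-one X = trans (count-cong (λ ℓ → ∧-idem (I Π X ℓ))) (pointLines Π X)

  lines-through-two : ∀ X P → P ≢ X → count (λ ℓ → I Π X ℓ ∧ I Π P ℓ) ≡ 1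
  lines-through-two X P P≢X with joinUnique Π X P (P≢X ∘ sym)
  ... | ℓ , (Xℓ , Pℓ) , unique = count-unique _ ℓ (cong₂ _∧_ Xℓ Pℓ) only-ℓ
    where
    only-ℓ : ∀ ℓ′ → (I Π X ℓ′ ∧ I Π P ℓ′) ≡ true → ℓ′ ≡ ℓ
    only-ℓ ℓ′ both = let Xℓ′ , Pℓ′ = both-true both in unique ℓ′ Xℓ′ Pℓ′

  -- Counting the flags (P, ℓ) with X on ℓ and P ∈ S ∩ ℓ in two ways:
  -- Σ_{ℓ ∋ X} |ℓ ∩ S| = Σ_{P ∈ S} #(lines through X and P).
  pencil-double-count : ∀ (S : PointSet Π) X →
    pencilSum X (meet Π S) ≡ sum (λ P → onlyIf (S P) (count (λ ℓ → I Π X ℓ ∧ I Π P ℓ)))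
  pencil-double-count S X = begin
    sum (λ ℓ → onlyIf (I Π X ℓ) (meet Π S ℓ))
      ≡⟨ sum-cong-≗ (λ ℓ → trans (cong (onlyIf (I Π X ℓ)) (count-as-sum (onS ℓ))) (onlyIf-sum (I Π X ℓ) (λ P → onlyIf (onS ℓ P) 1))) ⟩
    sum (λ ℓ → sum (λ P → onlyIf (I Π X ℓ) (onlyIf (I Π P ℓ ∧ S P) 1)))
      ≡⟨ ∑-comm (λ ℓ P → onlyIf (I Π X ℓ) (onlyIf (I Π P ℓ ∧ S P) 1)) ⟩
    sum (λ P → sum (λ ℓ → onlyIf (I Π X ℓ) (onlyIf (I Π P ℓ ∧ S P) 1)))
      ≡⟨ sum-cong-≗ (λ P → sum-cong-≗ (λ ℓ → reorder (I Π X ℓ) (I Π P ℓ) (S P))) ⟩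
    sum (λ P → sum (λ ℓ → onlyIf (S P) (onlyIf (I Π X ℓ ∧ I Π P ℓ) 1)))
      ≡⟨ sum-cong-≗ (λ P → trans (sym (onlyIf-sum (S P) (λ ℓ → onlyIf (joins P ℓ) 1))) (cong (onlyIf (S P)) (sym (count-as-sum (joins P))))) ⟩
    sum (λ P → onlyIf (S P) (count (λ ℓ → I Π X ℓ ∧ I Π P ℓ))) ∎
    where
    open ≡-Reasoning
    onS : Line Π → Point Π → Bool
    onS ℓ P = I Π P ℓ ∧ S P
    joins : Point Π → Line Π → Bool
    joins P ℓ = I Π X ℓ ∧ I Π P ℓ
    reorder : ∀ a b s → onlyIf a (onlyIf (b ∧ s) 1) ≡ onlyIf s (onlyIf (a ∧ b) 1)
    reorder true  true  s = refl
    reorder true  false s = sym (onlyIf-zero s)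
    reorder false b     s = sym (onlyIf-zero s)

  pencil-outside : ∀ (S : PointSet Π) Q → S Q ≡ false → pencilSum Q (meet Π S) ≡ count S
  pencil-outside S Q Q∉S =
    trans (pencil-double-count S Q) (trans (sum-cong-≗ one-line) (sym (count-as-sum S)))
    where
    one-line : ∀ P → onlyIf (S P) (count (λ ℓ → I Π Q ℓ ∧ I Π P ℓ)) ≡ onlyIf (S P) 1
    one-line P with S P in P∈S
    ... | false = refl
    ... | true  = lines-through-two Q P P≢Q
      where
      P≢Q : P ≢ Q
      P≢Q refl with trans (sym P∈S) Q∉S
      ... | ()

  -- The lines through a point R of S cover S, with R itself counted q + 1 times.
  pencil-inside : ∀ (S : PointSet Π) R → S R ≡ true → pencilSum R (meet Π S) ≡ count S + q
  pencil-inside S R R∈S = +-cancelʳ-≡ 1 _ _ (begin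
    pencilSum R (meet Π S) + 1
      ≡⟨ cong (_+ 1) (pencil-double-count S R) ⟩
    sum (λ P → onlyIf (S P) (count (λ ℓ → I Π R ℓ ∧ I Π P ℓ))) + 1
      ≡⟨ sum-onlyIf-except S _ R (suc q) 1 R∈S (lines-through-one R)
           (λ P _ P≢R → lines-through-two R P P≢R) ⟩
    count S * 1 + suc q
      ≡⟨ regroup (count S) q ⟩
    count S + q + 1 ∎)
    where
    open ≡-Reasoning
    regroup : ∀ n q → n * 1 + suc q ≡ n + q + 1
    regroup = solve-∀

module KMArc {q : ℕ} (Π : ProjectivePlane q) (p : ℕ) .{{_ : NonZero p}} {m t : ℕ}
             {S : PointSet Π} (arc : GenKMArc Π p m t S) where

  open DoubleCounting Π
  open Modulo p
  open GenKMArc arc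

  isTSecant : Line Π → Bool
  isTSecant ℓ = meet Π S ℓ % p ≡ᵇ t

  -- A line meeting S that is not a t_p-secant is an m_p-secant: it passes
  -- through a point of S, whose only t_p-secant is a different line.
  non-tangent-is-m : ∀ ℓ → meet Π S ℓ ≢ 0 → isTSecant ℓ ≡ false → Secant Π p m S ℓ
  non-tangent-is-m ℓ meets not-t with count-witness (λ P → I Π P ℓ ∧ S P) meets
  ... | P , Pℓ∧P∈S with both-true Pℓ∧P∈S
  ... | Pℓ , P∈S with tangent P P∈S
  ... | ℓ₀ , _ , ℓ₀-is-t , others-m with ℓ Fin.≟ ℓ₀
  ... | yes refl = ⊥-elim (subst T not-t (≡⇒≡ᵇ _ _ ℓ₀-is-t))
  ... | no ℓ≢ℓ₀  = others-m ℓ Pℓ ℓ≢ℓ₀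

  -- The size of an arc in a plane of order divisible by p is ≡ t:
  -- count S through a point R of S, lying on one t_p- and q m_p-secants.
  arc-size : p ∣ q → count S ≡ t mod p
  arc-size p∣q = begin
    count S % p                             ≡⟨ sym (%-remove-+ʳ (count S) p∣q) ⟩
    (count S + q) % p                       ≡⟨ cong (_% p) (sym (pencil-inside S R R∈S)) ⟩
    pencilSum R (meet Π S) % p              ≡⟨ sum-onlyIf-mod (I Π R) (meet Π S) ⟩
    pencilSum R (λ ℓ → meet Π S ℓ % p) % p  ≡⟨ cong (_% p) residues ⟩
    (q * m + t) % p                         ≡⟨ %-remove-+ˡ t (∣m⇒∣m*n m p∣q) ⟩
    t % p                                   ∎
    where
    open ≡-Reasoning
    R = proj₁ nonEmpty
    R∈S = proj₂ nonEmpty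
    residues : pencilSum R (λ ℓ → meet Π S ℓ % p) ≡ q * m + t
    residues with tangent R R∈S
    ... | ℓ₀ , Rℓ₀ , ℓ₀-is-t , others-m = +-cancelʳ-≡ m _ _ (begin
      pencilSum R (λ ℓ → meet Π S ℓ % p) + m
        ≡⟨ sum-onlyIf-except (I Π R) _ ℓ₀ t m Rℓ₀ ℓ₀-is-t others-m ⟩
      count (I Π R) * m + t   ≡⟨ cong (λ k → k * m + t) (pointLines Π R) ⟩
      suc q * m + t           ≡⟨ regroup q m t ⟩
      q * m + t + m           ∎)
      where
      regroup : ∀ q m t → suc q * m + t ≡ q * m + t + m
      regroup = solve-∀

  NoZeroSecantThroughOrMZero : Point Π → Set
  NoZeroSecantThroughOrMZero Q = (∀ ℓ → I Π Q ℓ ≡ true → ¬ ZeroSecant Π S ℓ) ⊎ m ≡ 0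

  -- Under this hypothesis every line through Q that is not a t_p-secant is
  -- an m_p-secant (a 0-secant being one when m = 0).
  non-t-through-is-m : ∀ Q → NoZeroSecantThroughOrMZero Q →
    ∀ ℓ → I Π Q ℓ ≡ true → isTSecant ℓ ≡ false → meet Π S ℓ % p ≡ m
  non-t-through-is-m Q (inj₁ no-0-secant) ℓ Qℓ not-t =
    non-tangent-is-m ℓ (no-0-secant ℓ Qℓ) not-t
  non-t-through-is-m Q (inj₂ m≡0) ℓ Qℓ not-t with meet Π S ℓ ≟ 0
  ... | no  ≢0 = non-tangent-is-m ℓ ≢0 not-t
  ... | yes ≡0 = trans (cong (_% p) ≡0) (trans 0%p≡0 (sym m≡0))

  external-count : ∀ Q → S Q ≡ false → NoZeroSecantThroughOrMZero Q →
    count S ≡ count (λ ℓ → I Π Q ℓ ∧ isTSecant ℓ) * t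
              + count (λ ℓ → I Π Q ℓ ∧ not (isTSecant ℓ)) * m mod p
  external-count Q Q∉S hyp = begin
    count S % p                              ≡⟨ cong (_% p) (sym (pencil-outside S Q Q∉S)) ⟩
    pencilSum Q (meet Π S) % p               ≡⟨ sum-onlyIf-mod (I Π Q) (meet Π S) ⟩
    pencilSum Q (λ ℓ → meet Π S ℓ % p) % p   ≡⟨ cong (_% p) (sum-cong-≗ classify) ⟩
    sum (λ ℓ → onlyIf (I Π Q ℓ) (if isTSecant ℓ then t else m)) % p
      ≡⟨ cong (_% p) (sum-onlyIf-if (I Π Q) isTSecant t m) ⟩
    (count (λ ℓ → I Π Q ℓ ∧ isTSecant ℓ) * t
      + count (λ ℓ → I Π Q ℓ ∧ not (isTSecant ℓ)) * m) % p ∎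
    where
    open ≡-Reasoning
    classify : ∀ ℓ → onlyIf (I Π Q ℓ) (meet Π S ℓ % p) ≡
                     onlyIf (I Π Q ℓ) (if isTSecant ℓ then t else m)
    classify ℓ with I Π Q ℓ in Qℓ | isTSecant ℓ in t?
    ... | false | _     = refl
    ... | true  | true  = ≡ᵇ⇒≡ _ _ (subst T (sym t?) tt)
    ... | true  | false = non-t-through-is-m Q hyp ℓ Qℓ t?

lemma3p6 : (p n : ℕ) → Prime p → .{{_ : NonZero p}} → 1 ≤ n →
    (Π : ProjectivePlane (p ^ n)) →
    (m t : ℕ) → m < p → t < p → t ≢ m →
    (S : PointSet Π) → GenKMArc Π p m t S →
    (Q : Point Π) → S Q ≡ false →
    ((∀ ℓ → I Π Q ℓ ≡ true → ¬ ZeroSecant Π S ℓ) ⊎ m ≡ 0) →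
    numSecantsThrough Π p t S Q % p ≡ 1
lemma3p6 p (suc k) p-prime _ Π m t m<p t<p t≢m S arc Q Q∉S hyp =
  trans (solve-for-x p-prime x y m<p t<p t≢m (trans (sym through-Q) through-arc) x+y≡1)
        (m<n⇒m%n≡m (nonTrivial⇒n>1 p {{prime⇒nonTrivial p-prime}}))
  where
  open Modulo p
  open KMArc Π p arc
  q = p ^ suc k
  p∣q : p ∣ q
  p∣q = m∣m*n (p ^ k)
  x = count (λ ℓ → I Π Q ℓ ∧ isTSecant ℓ)
  y = count (λ ℓ → I Π Q ℓ ∧ not (isTSecant ℓ))
  through-Q : count S ≡ x * t + y * m mod p
  through-Q = external-count Q Q∉S hyp
  through-arc : count S ≡ t mod p
  through-arc = arc-size p∣q
  -- The q + 1 lines through Q.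
  x+y≡1 : x + y ≡ 1 mod p
  x+y≡1 = begin
    (x + y) % p  ≡⟨ cong (_% p) (trans (sym (count-split (I Π Q) isTSecant)) (pointLines Π Q)) ⟩
    (1 + q) % p  ≡⟨ %-remove-+ʳ 1 p∣q ⟩
    1 % p        ∎
    where open ≡-Reasoning
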